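{- Let $A,B$ be two $(n,d)$-types with $A\subseteq B$. Then $A$ is a refinement of $B$ if and only if the comparability graph $G_{A,B}$ is acyclic.
   Context: $[d]=\{1,\dots,d\}$. An $(n,d)$-type is an $n$-tuple $A=(A_1,\dots,A_n)$ of non-empty subsets of $[d]$; $A\subseteq B$ means $A_i\subseteq B_i$ for all $i$. For an ordered partition $P=(P_1,\dots,P_k)$ of $[d]$, the refinement $B|_P$ is the type $C$ with $C_i=B_i\cap P_{m(i)}$, where $m(i)$ is the smallest index with $B_i\cap P_{m(i)}\neq\emptyset$; $A$ is a refinement of $B$ if $A=B|_P$ for some ordered partition $P$. The comparability graph $G_{A,B}$ is the multigraph (without loops) on node set $[d]$ having, for each $i\in[n]$ and each $j\in A_i$, $k\in B_i$ with $j\neq k$, an edge which is undirected if $j,k\in A_i\cap B_i$ and directed $j\to k$ otherwise. A directed cycle is a closed sequence of incident edges at least one of which is directed and all directed edges of which point in the same direction along the sequence; $G_{A,B}$ is acyclic if it contains no directed cycle. -}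

module Defs where

open import Data.Nat using (ℕ)
open import Data.Fin using (Fin; _<_)
open import Data.Fin.Subset using (Subset; _∈_; _∩_; _⊆_; Nonempty; Empty)
open import Data.Product using (Σ; ∃; ∃-syntax; _×_; _,_)
open import Relation.Binary.PropositionalEquality using (_≡_; _≢_)
open import Relation.Nullary using (¬_)

record Type (n d : ℕ) : Set where
  field
    set      : Fin n → Subset d
    nonempty : ∀ i → Nonempty (set i)
open Type public

_⊆ᵀ_ : ∀ {n d} → Type n d → Type n d → Set
A ⊆ᵀ B = ∀ i → set A i ⊆ set B i

record OrderedPartition (d : ℕ) : Set where
  field
    k        : ℕ
    block    : Fin k → Subset d
    block-ne : ∀ a → Nonempty (block a)
    disjoint : ∀ a b → a ≢ b → Empty (block a ∩ block b)
    cover    : ∀ x → ∃[ a ] (x ∈ block a)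
open OrderedPartition public

IsRefinementVia : ∀ {n d} → Type n d → Type n d → OrderedPartition d → Set
IsRefinementVia {n} A B P =
  ∀ (i : Fin n) → ∃[ m ]
    ( Nonempty (set B i ∩ block P m)
    × (∀ m' → m' < m → Empty (set B i ∩ block P m'))
    × set A i ≡ set B i ∩ block P m )

IsRefinement : ∀ {n d} → Type n d → Type n d → Set
IsRefinement {d = d} A B = ∃[ P ] IsRefinementVia {d = d} A B P

record Edge {n d : ℕ} (A B : Type n d) : Set where
  field
    idx  : Fin n
    src  : Fin d
    tgt  : Fin d
    src∈ : src ∈ set A idx
    tgt∈ : tgt ∈ set B idx
    src≢tgt : src ≢ tgt
open Edge public

-- undirected iff both endpoints lie in A_i ∩ B_i; otherwise directed src → tgt
Undirected : ∀ {n d} {A B : Type n d} → Edge A B → Set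
Undirected {A = A} {B} e =
  (src e ∈ (set A (idx e) ∩ set B (idx e))) × (tgt e ∈ (set A (idx e) ∩ set B (idx e)))

Directed : ∀ {n d} {A B : Type n d} → Edge A B → Set
Directed e = ¬ Undirected e

data Dir : Set where
  fwd bwd : Dir

data Step {n d} {A B : Type n d} : Fin d → Fin d → Set where
  along   : (e : Edge A B) → Step (src e) (tgt e)
  against : (e : Edge A B) → Step (tgt e) (src e)

stepEdge : ∀ {n d} {A B : Type n d} {u v} → Step {A = A} {B} u v → Edge A B
stepEdge (along e)   = e
stepEdge (against e) = e

stepDir : ∀ {n d} {A B : Type n d} {u v} → Step {A = A} {B} u v → Dir
stepDir (along _)   = fwd
stepDir (against _) = bwd

data Walk {n d} (A B : Type n d) : Fin d → Fin d → Set where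
  []  : ∀ {u} → Walk A B u u
  _∷_ : ∀ {u v w} → Step {A = A} {B} u v → Walk A B v w → Walk A B u w

DirectedAlong : ∀ {n d} {A B : Type n d} {u v} → Dir → Walk A B u v → Set
DirectedAlong δ []       = Data.Unit.⊤ where import Data.Unit
DirectedAlong δ (s ∷ w)  = (Directed (stepEdge s) → stepDir s ≡ δ) × DirectedAlong δ w

data SomeDirected {n d} {A B : Type n d} : ∀ {u v} → Walk A B u v → Set where
  here  : ∀ {u v w} {s : Step u v} {ws : Walk A B v w} → Directed (stepEdge s) → SomeDirected (s ∷ ws)
  there : ∀ {u v w} {s : Step u v} {ws : Walk A B v w} → SomeDirected ws → SomeDirected (s ∷ ws)

DirectedCycle : ∀ {n d} → Type n d → Type n d → Set
DirectedCycle {d = d} A B =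
  Σ (Fin d) λ u → Σ (Walk A B u u) λ w → Σ Dir λ δ → DirectedAlong δ w × SomeDirected w

Acyclic : ∀ {n d} → Type n d → Type n d → Set
Acyclic A B = ¬ DirectedCycle A B

-- Both conditions are equivalent to the existence of a ranking r : [d] → ℕ for which every A i
-- is the set of r-minimal elements of B i.  The block indices of a refinement form such a
-- ranking, and conversely the nonempty level sets of a ranking, listed in increasing order,
-- form an ordered partition P with A = B|_P.  A ranking is a potential that every edge of
-- G_{A,B} weakly increases and every directed edge strictly increases, so there is no
-- directed cycle.  Conversely, if G_{A,B} is acyclic then the number of ancestors of a node
-- (the nodes with a walk to it along edges traversed forwards) is a ranking: an edge j → k
-- makes every ancestor of j an ancestor of k, and a directed one adds k itself.
module Submission where

open import Defs
open import Data.Nat using (ℕ; zero; suc; _≤_; _<_; z≤n; s≤s; _≟_; _≤?_)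
open import Data.Nat.Properties
  using (≤-refl; ≤-reflexive; ≤-trans; <⇒≤; <-≤-trans; ≤-<-trans; <-irrefl; <-asym; <-cmp;
         n≤1+n; 1+n≰n; <⇒≱; ≰⇒>; m≤n⇒m<n∨m≡n; m<1+n⇒m<n∨m≡n)
open import Data.Nat.GeneralisedArithmetic using (fold)
open import Data.Product using (_×_; _,_; proj₁; proj₂; Σ; ∃)
open import Data.Sum using (_⊎_; inj₁; inj₂)
open import Data.Empty using (⊥-elim)
open import Data.Unit using (tt)
open import Data.Fin as Fin using (Fin; toℕ; fromℕ<)
open import Data.Fin.Properties using (any?; toℕ-injective; toℕ-fromℕ<; toℕ<n)
open import Data.Fin.Subset using (Subset; _∈_; _∉_; _∩_; _⊆_; Nonempty; Empty; ⁅_⁆; ∣_∣)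
open import Data.Fin.Subset.Properties
  using (_∈?_; x∈p∩q⁺; x∈p∩q⁻; ⊆-antisym; p⊂q⇒∣p∣<∣q∣; ∣p∣≤n; x∈⁅x⁆; x∈⁅y⁆⇒x≡y)
open import Data.Vec using (tabulate)
open import Data.Vec.Properties using (lookup∘tabulate; lookup⇒[]=; []=⇒lookup)
open import Function using (_∘_)
open import Relation.Nullary using (¬_; Dec; yes; no; does; proof)
open import Relation.Nullary.Decidable using (dec-true; _×-dec_; _⊎-dec_)
open import Relation.Nullary.Reflects using (Reflects; invert)
open import Relation.Unary using (Decidable)
open import Relation.Binary.PropositionalEquality using (_≡_; _≢_; refl; sym; trans; cong; subst; subst₂)
open import Relation.Binary.Definitions using (tri<; tri≈; tri>)

module _ {d : ℕ} {P : Fin d → Set} (P? : Decidable P) where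

  subsetOf : Subset d
  subsetOf = tabulate (does ∘ P?)

  ∈-subsetOf⁺ : ∀ {x} → P x → x ∈ subsetOf
  ∈-subsetOf⁺ {x} px =
    lookup⇒[]= x _ (trans (lookup∘tabulate _ x) (dec-true (P? x) px))

  ∈-subsetOf⁻ : ∀ {x} → x ∈ subsetOf → P x
  ∈-subsetOf⁻ {x} x∈ =
    invert (subst (Reflects (P x)) (trans (sym (lookup∘tabulate _ x)) ([]=⇒lookup x∈)) (proof (P? x)))

module _ {d : ℕ} (f : Subset d → Subset d) (inflationary : ∀ S → S ⊆ f S) where

  fixed-or-grows : ∀ S → f S ≡ S ⊎ ∣ S ∣ < ∣ f S ∣
  fixed-or-grows S with ∣ f S ∣ ≤? ∣ S ∣
  ... | no  ∣fS∣≰∣S∣ = inj₂ (≰⇒> ∣fS∣≰∣S∣)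
  ... | yes ∣fS∣≤∣S∣ = inj₁ (⊆-antisym fS⊆S (inflationary S))
    where
    fS⊆S : f S ⊆ S
    fS⊆S {x} x∈fS with x ∈? S
    ... | yes x∈S = x∈S
    ... | no  x∉S = ⊥-elim (<⇒≱ (p⊂q⇒∣p∣<∣q∣ (inflationary S , x , x∈fS , x∉S)) ∣fS∣≤∣S∣)

  fold-fixed-or-grows : ∀ t S → f (fold S f t) ≡ fold S f t ⊎ t ≤ ∣ fold S f t ∣
  fold-fixed-or-grows zero    S = inj₂ z≤n
  fold-fixed-or-grows (suc t) S with fold-fixed-or-grows t S
  ... | inj₁ fixed = inj₁ (cong f fixed)
  ... | inj₂ t≤ with fixed-or-grows (fold S f t)
  ...   | inj₁ fixed = inj₁ (cong f fixed)
  ...   | inj₂ grows = inj₂ (≤-<-trans t≤ grows)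

  -- a subset of Fin d cannot grow d + 1 times
  fold-suc-fixed : ∀ S → f (fold S f (suc d)) ≡ fold S f (suc d)
  fold-suc-fixed S with fold-fixed-or-grows (suc d) S
  ... | inj₁ fixed = fixed
  ... | inj₂ 1+d≤ = ⊥-elim (1+n≰n (≤-trans 1+d≤ (∣p∣≤n (fold S f (suc d)))))

module Closure {d : ℕ} {_⟶_ : Fin d → Fin d → Set} (_⟶?_ : ∀ j k → Dec (j ⟶ k)) where

  Closed : Subset d → Set
  Closed T = ∀ {j k} → j ⟶ k → j ∈ T → k ∈ T

  OneStep : Subset d → Fin d → Set
  OneStep S k = k ∈ S ⊎ ∃ λ j → j ∈ S × j ⟶ k

  oneStep? : ∀ S → Decidable (OneStep S)
  oneStep? S k = k ∈? S ⊎-dec any? (λ j → j ∈? S ×-dec j ⟶? k)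

  expand : Subset d → Subset d
  expand S = subsetOf (oneStep? S)

  ⊆-expand : ∀ S → S ⊆ expand S
  ⊆-expand S x∈S = ∈-subsetOf⁺ (oneStep? S) (inj₁ x∈S)

  closure : Subset d → Subset d
  closure S = fold S expand (suc d)

  ⊆-closure : ∀ {S} → S ⊆ closure S
  ⊆-closure {S} = fold-⊆ (suc d)
    where
    fold-⊆ : ∀ t → S ⊆ fold S expand t
    fold-⊆ zero    x∈S = x∈S
    fold-⊆ (suc t) x∈S = ⊆-expand _ (fold-⊆ t x∈S)

  closure-closed : ∀ {S} → Closed (closure S)
  closure-closed {S} j⟶k j∈ =
    subst (_ ∈_) (fold-suc-fixed expand ⊆-expand S) (∈-subsetOf⁺ (oneStep? _) (inj₂ (_ , j∈ , j⟶k)))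

  closure-ind : ∀ {S} (Q : Fin d → Set) → (∀ {x} → x ∈ S → Q x) →
                (∀ {j k} → j ⟶ k → Q j → Q k) → ∀ {x} → x ∈ closure S → Q x
  closure-ind {S} Q base step = fold-ind (suc d)
    where
    fold-ind : ∀ t {x} → x ∈ fold S expand t → Q x
    fold-ind zero    x∈ = base x∈
    fold-ind (suc t) x∈ with ∈-subsetOf⁻ (oneStep? _) x∈
    ... | inj₁ x∈′             = fold-ind t x∈′
    ... | inj₂ (_ , j∈ , j⟶x) = step j⟶x (fold-ind t j∈)

record Ranking {n d : ℕ} (A B : Type n d) (r : Fin d → ℕ) : Set where
  field
    ties  : ∀ i {j k} → j ∈ set A i → k ∈ set A i → r j ≡ r k
    below : ∀ i {j k} → j ∈ set A i → k ∈ set B i → k ∉ set A i → r j < r k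
open Ranking

Ranking-reindex : ∀ {n d} {A B : Type n d} {r s : Fin d → ℕ} →
                  (∀ {x y} → r x ≡ r y → s x ≡ s y) → (∀ {x y} → r x < r y → s x < s y) →
                  Ranking A B r → Ranking A B s
Ranking-reindex ≡-pres <-pres ρ = record
  { ties  = λ i j∈A k∈A → ≡-pres (ties ρ i j∈A k∈A)
  ; below = λ i j∈A k∈B k∉A → <-pres (below ρ i j∈A k∈B k∉A)
  }

module _ {d : ℕ} (P : OrderedPartition d) where

  blockOf : Fin d → Fin (k P)
  blockOf x = proj₁ (cover P x)

  level : Fin d → ℕ
  level = toℕ ∘ blockOf

  ∈-blockOf : ∀ x → x ∈ block P (blockOf x)
  ∈-blockOf x = proj₂ (cover P x)

  ∈-block⇒≡blockOf : ∀ {x a} → x ∈ block P a → a ≡ blockOf x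
  ∈-block⇒≡blockOf {x} {a} x∈a with a Fin.≟ blockOf x
  ... | yes a≡ = a≡
  ... | no  a≢ = ⊥-elim (disjoint P a (blockOf x) a≢ (x , x∈p∩q⁺ (x∈a , ∈-blockOf x)))

module _ {n d : ℕ} {A B : Type n d} {P : OrderedPartition d} where

  refinementVia⇒ranking : IsRefinementVia A B P → Ranking A B (level P)
  refinementVia⇒ranking via = record
    { ties  = λ i j∈A k∈A → cong toℕ (trans (blockOf-A j∈A) (sym (blockOf-A k∈A)))
    ; below = λ i j∈A k∈B k∉A →
        subst (_< _) (cong toℕ (sym (blockOf-A j∈A))) (outside-A⇒after-first i k∈B k∉A)
    }
    where
    first : Fin n → Fin (k P)
    first i = proj₁ (via i)

    before-first-empty : ∀ i a → a Fin.< first i → Empty (set B i ∩ block P a)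
    before-first-empty i = proj₁ (proj₂ (proj₂ (via i)))

    A≡B∩first : ∀ i → set A i ≡ set B i ∩ block P (first i)
    A≡B∩first i = proj₂ (proj₂ (proj₂ (via i)))

    blockOf-A : ∀ {i x} → x ∈ set A i → blockOf P x ≡ first i
    blockOf-A {i} x∈A =
      sym (∈-block⇒≡blockOf P (proj₂ (x∈p∩q⁻ _ _ (subst (_ ∈_) (A≡B∩first i) x∈A))))

    outside-A⇒after-first : ∀ i {k} → k ∈ set B i → k ∉ set A i → first i Fin.< blockOf P k
    outside-A⇒after-first i {k} k∈B k∉A with <-cmp (level P k) (toℕ (first i))
    ... | tri< k<first _ _ =
      ⊥-elim (before-first-empty i (blockOf P k) k<first (k , x∈p∩q⁺ (k∈B , ∈-blockOf P k)))
    ... | tri≈ _ k≡first _ =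
      ⊥-elim (k∉A (subst (k ∈_) (sym (A≡B∩first i))
        (x∈p∩q⁺ (k∈B , subst (λ a → k ∈ block P a) (toℕ-injective k≡first) (∈-blockOf P k)))))
    ... | tri> _ _ first<k = first<k

  ranking⇒refinementVia : A ⊆ᵀ B → Ranking A B (level P) → IsRefinementVia A B P
  ranking⇒refinementVia A⊆B ρ i with nonempty A i
  ... | j , j∈A = blockOf P j , (j , x∈p∩q⁺ (A⊆B i j∈A , ∈-blockOf P j)) , minimal
                , ⊆-antisym A⊆B∩block B∩block⊆A
    where
    same-block : ∀ {x} → x ∈ set A i → blockOf P x ≡ blockOf P j
    same-block x∈A = toℕ-injective (ties ρ i x∈A j∈A)

    ∉A⇒later : ∀ {x} → x ∈ set B i → x ∉ set A i → blockOf P j Fin.< blockOf P x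
    ∉A⇒later = below ρ i j∈A

    minimal : ∀ a → a Fin.< blockOf P j → Empty (set B i ∩ block P a)
    minimal a a<j (y , y∈B∩a) with x∈p∩q⁻ _ _ y∈B∩a
    ... | y∈B , y∈a rewrite ∈-block⇒≡blockOf P y∈a with y ∈? set A i
    ...   | yes y∈A = <-irrefl (cong toℕ (same-block y∈A)) a<j
    ...   | no  y∉A = <-asym a<j (∉A⇒later y∈B y∉A)

    A⊆B∩block : set A i ⊆ set B i ∩ block P (blockOf P j)
    A⊆B∩block {x} x∈A =
      x∈p∩q⁺ (A⊆B i x∈A , subst (λ a → x ∈ block P a) (same-block x∈A) (∈-blockOf P x))

    B∩block⊆A : set B i ∩ block P (blockOf P j) ⊆ set A i
    B∩block⊆A {x} x∈B∩j with x∈p∩q⁻ _ _ x∈B∩j | x ∈? set A i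
    ... | _         | yes x∈A = x∈A
    ... | x∈B , x∈j | no  x∉A =
      ⊥-elim (<-irrefl (cong toℕ (∈-block⇒≡blockOf P x∈j)) (∉A⇒later x∈B x∉A))

module LevelPartition {d : ℕ} (r : Fin d → ℕ) (M : ℕ) (r<M : ∀ x → r x < M) where

  Attained : ℕ → Set
  Attained v = ∃ λ x → r x ≡ v

  attained? : Decidable Attained
  attained? v = any? (λ x → r x ≟ v)

  dense : ℕ → ℕ
  dense zero = zero
  dense (suc v) with attained? v
  ... | yes _ = suc (dense v)
  ... | no  _ = dense v

  dense-≤-suc : ∀ v → dense v ≤ dense (suc v)
  dense-≤-suc v with attained? v
  ... | yes _ = n≤1+n (dense v)
  ... | no  _ = ≤-refl

  dense-mono : ∀ {v w} → v ≤ w → dense v ≤ dense w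
  dense-mono {w = zero}  z≤n  = ≤-refl
  dense-mono {w = suc w} v≤1+w with m≤n⇒m<n∨m≡n v≤1+w
  ... | inj₁ (s≤s v≤w) = ≤-trans (dense-mono v≤w) (dense-≤-suc w)
  ... | inj₂ refl      = ≤-refl

  dense-strict : ∀ {v w} → Attained v → v < w → dense v < dense w
  dense-strict {v} att v<w with attained? v | dense-mono v<w
  ... | yes _    | 1+dv≤dw = 1+dv≤dw
  ... | no  ¬att | _       = ⊥-elim (¬att att)

  dense-onto : ∀ w {m} → m < dense w → ∃ λ v → Attained v × dense v ≡ m
  dense-onto (suc w) m<dw with attained? w
  ... | no  _   = dense-onto w m<dw
  ... | yes att with m<1+n⇒m<n∨m≡n m<dw
  ...   | inj₁ m<dw′ = dense-onto w m<dw′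
  ...   | inj₂ refl  = w , att , refl

  dense-r<dense-M : ∀ x → dense (r x) < dense M
  dense-r<dense-M x = dense-strict (x , refl) (r<M x)

  levelSet : Fin (dense M) → Subset d
  levelSet m = subsetOf (λ x → dense (r x) ≟ toℕ m)

  partition : OrderedPartition d
  partition = record
    { k        = dense M
    ; block    = levelSet
    ; block-ne = nonempty-levelSet
    ; disjoint = λ a b a≢b (x , x∈a∩b) → a≢b (toℕ-injective
                   (trans (sym (level-of (proj₁ (x∈p∩q⁻ _ _ x∈a∩b))))
                          (level-of (proj₂ (x∈p∩q⁻ _ _ x∈a∩b)))))
    ; cover    = λ x → fromℕ< (dense-r<dense-M x) , in-level (sym (toℕ-fromℕ< (dense-r<dense-M x)))
    }
    where
    in-level : ∀ {x m} → dense (r x) ≡ toℕ m → x ∈ levelSet m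
    in-level {x} {m} = ∈-subsetOf⁺ (λ x → dense (r x) ≟ toℕ m)

    level-of : ∀ {x m} → x ∈ levelSet m → dense (r x) ≡ toℕ m
    level-of {x} {m} = ∈-subsetOf⁻ (λ x → dense (r x) ≟ toℕ m)

    nonempty-levelSet : ∀ m → Nonempty (levelSet m)
    nonempty-levelSet m with dense-onto M (toℕ<n m)
    ... | _ , (y , refl) , dense≡m = y , in-level dense≡m

  level≡dense : ∀ x → level partition x ≡ dense (r x)
  level≡dense x = toℕ-fromℕ< (dense-r<dense-M x)

  reindex-ranking : ∀ {n} {A B : Type n d} → Ranking A B r → Ranking A B (level partition)
  reindex-ranking = Ranking-reindex
    (λ {x} {y} rx≡ry → trans (level≡dense x) (trans (cong dense rx≡ry) (sym (level≡dense y))))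
    (λ {x} {y} rx<ry → subst₂ _<_ (sym (level≡dense x)) (sym (level≡dense y))
                          (dense-strict (x , refl) rx<ry))

Oriented : Dir → (ℕ → ℕ → Set) → ℕ → ℕ → Set
Oriented fwd _∼_ m n = m ∼ n
Oriented bwd _∼_ m n = n ∼ m

oriented-≤-reflexive : ∀ δ {m n} → m ≡ n → Oriented δ _≤_ m n
oriented-≤-reflexive fwd m≡n = ≤-reflexive m≡n
oriented-≤-reflexive bwd m≡n = ≤-reflexive (sym m≡n)

oriented-≤-trans : ∀ δ {l m n} → Oriented δ _≤_ l m → Oriented δ _≤_ m n → Oriented δ _≤_ l n
oriented-≤-trans fwd l≤m m≤n = ≤-trans l≤m m≤n
oriented-≤-trans bwd m≤l n≤m = ≤-trans n≤m m≤l

oriented-<-≤-trans : ∀ δ {l m n} → Oriented δ _<_ l m → Oriented δ _≤_ m n → Oriented δ _<_ l n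
oriented-<-≤-trans fwd l<m m≤n = <-≤-trans l<m m≤n
oriented-<-≤-trans bwd m<l n≤m = ≤-<-trans n≤m m<l

oriented-≤-<-trans : ∀ δ {l m n} → Oriented δ _≤_ l m → Oriented δ _<_ m n → Oriented δ _<_ l n
oriented-≤-<-trans fwd l≤m m<n = ≤-<-trans l≤m m<n
oriented-≤-<-trans bwd m≤l n<m = <-≤-trans n<m m≤l

oriented-<-irrefl : ∀ δ {m} → ¬ Oriented δ _<_ m m
oriented-<-irrefl fwd = <-irrefl refl
oriented-<-irrefl bwd = <-irrefl refl

module _ {n d : ℕ} {A B : Type n d} (A⊆B : A ⊆ᵀ B) {r : Fin d → ℕ} (ρ : Ranking A B r) where

  edge-rank : (e : Edge A B) →
              (Undirected e × r (src e) ≡ r (tgt e)) ⊎ (Directed e × r (src e) < r (tgt e))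
  edge-rank e with tgt e ∈? set A (idx e)
  ... | yes tgt∈A = inj₁ ( (x∈p∩q⁺ (src∈ e , A⊆B _ (src∈ e)) , x∈p∩q⁺ (tgt∈A , tgt∈ e))
                         , ties ρ _ (src∈ e) tgt∈A )
  ... | no  tgt∉A = inj₂ ( (λ undirected → tgt∉A (proj₁ (x∈p∩q⁻ _ _ (proj₂ undirected))))
                         , below ρ _ (src∈ e) (tgt∈ e) tgt∉A )

  step-rank : ∀ {δ u v} (s : Step {A = A} {B} u v) → (Directed (stepEdge s) → stepDir s ≡ δ) →
              Oriented δ _≤_ (r u) (r v) × (Directed (stepEdge s) → Oriented δ _<_ (r u) (r v))
  step-rank {δ} (along e) orient with edge-rank e
  ... | inj₁ (undirected , eq) =
    oriented-≤-reflexive δ eq , λ directed → ⊥-elim (directed undirected)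
  ... | inj₂ (directed , lt) with orient directed
  ...   | refl = <⇒≤ lt , λ _ → lt
  step-rank {δ} (against e) orient with edge-rank e
  ... | inj₁ (undirected , eq) =
    oriented-≤-reflexive δ (sym eq) , λ directed → ⊥-elim (directed undirected)
  ... | inj₂ (directed , lt) with orient directed
  ...   | refl = <⇒≤ lt , λ _ → lt

  walk-rank : ∀ {δ u v} (w : Walk A B u v) → DirectedAlong δ w →
              Oriented δ _≤_ (r u) (r v) × (SomeDirected w → Oriented δ _<_ (r u) (r v))
  walk-rank {δ} []      _             = oriented-≤-reflexive δ refl , λ ()
  walk-rank {δ} (s ∷ w) (orient , da) with step-rank s orient | walk-rank w da
  ... | s≤ , s< | w≤ , w< = oriented-≤-trans δ s≤ w≤ , λ
    { (here directed) → oriented-<-≤-trans δ (s< directed) w≤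
    ; (there some)    → oriented-≤-<-trans δ s≤ (w< some)
    }

  ranking⇒acyclic : Acyclic A B
  ranking⇒acyclic (_ , w , δ , da , some) = oriented-<-irrefl δ (proj₂ (walk-rank w da) some)

module Ancestors {n d : ℕ} {A B : Type n d} (A⊆B : A ⊆ᵀ B) where

  Joined : Fin d → Fin d → Set
  Joined j k = ∃ λ i → j ∈ set A i × k ∈ set B i

  joined? : ∀ j k → Dec (Joined j k)
  joined? j k = any? (λ i → j ∈? set A i ×-dec k ∈? set B i)

  open Closure (λ k j → joined? j k) using (closure; ⊆-closure; closure-closed; closure-ind)

  ancestors : Fin d → Subset d
  ancestors x = closure ⁅ x ⁆

  ∈-ancestors : ∀ x → x ∈ ancestors x
  ∈-ancestors x = ⊆-closure (x∈⁅x⁆ x)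

  edge : ∀ {i j k} → j ∈ set A i → k ∈ set B i → j ≢ k → Edge A B
  edge {i} {j} {k} j∈A k∈B j≢k =
    record { idx = i ; src = j ; tgt = k ; src∈ = j∈A ; tgt∈ = k∈B ; src≢tgt = j≢k }

  ForwardWalk : Fin d → Fin d → Set
  ForwardWalk u v = Σ (Walk A B u v) (DirectedAlong fwd)

  ancestor⇒forwardWalk : ∀ {x y} → y ∈ ancestors x → ForwardWalk y x
  ancestor⇒forwardWalk {x} = closure-ind (λ y → ForwardWalk y x) start extend
    where
    start : ∀ {y} → y ∈ ⁅ x ⁆ → ForwardWalk y x
    start y∈⁅x⁆ with x∈⁅y⁆⇒x≡y x y∈⁅x⁆
    ... | refl = [] , tt

    extend : ∀ {k j} → Joined j k → ForwardWalk k x → ForwardWalk j x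
    extend {k} {j} (i , j∈A , k∈B) w with j Fin.≟ k
    ... | yes refl = w
    ... | no  j≢k  = along (edge j∈A k∈B j≢k) ∷ proj₁ w , (λ _ → refl) , proj₂ w

  joined⇒ancestors-⊆ : ∀ {j k} → Joined j k → ancestors j ⊆ ancestors k
  joined⇒ancestors-⊆ {j} {k} joined = closure-ind (_∈ ancestors k) j∈ closure-closed
    where
    j∈ : ∀ {y} → y ∈ ⁅ j ⁆ → y ∈ ancestors k
    j∈ y∈⁅j⁆ with x∈⁅y⁆⇒x≡y j y∈⁅j⁆
    ... | refl = closure-closed joined (∈-ancestors k)

  -- a forward walk from k back to j would close a directed cycle with the edge j → k
  directed⇒∉ancestors : ∀ {i j k} → Acyclic A B → j ∈ set A i → k ∈ set B i → k ∉ set A i →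
                        k ∉ ancestors j
  directed⇒∉ancestors {i} {j} {k} acyclic j∈A k∈B k∉A k∈ with ancestor⇒forwardWalk k∈
  ... | w , da = acyclic (j , along e ∷ w , fwd , ((λ _ → refl) , da) , here directed)
    where
    e : Edge A B
    e = edge j∈A k∈B (λ j≡k → k∉A (subst (_∈ set A i) j≡k j∈A))

    directed : Directed e
    directed undirected = k∉A (proj₁ (x∈p∩q⁻ _ _ (proj₂ undirected)))

  acyclic⇒ranking : Acyclic A B → Ranking A B (∣_∣ ∘ ancestors)
  acyclic⇒ranking acyclic = record
    { ties  = λ i j∈A k∈A → cong ∣_∣ (⊆-antisym (joined⇒ancestors-⊆ (i , j∈A , A⊆B i k∈A))
                                              (joined⇒ancestors-⊆ (i , k∈A , A⊆B i j∈A)))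
    ; below = λ i {j} {k} j∈A k∈B k∉A → p⊂q⇒∣p∣<∣q∣
        ( joined⇒ancestors-⊆ (i , j∈A , k∈B)
        , k , ∈-ancestors k , directed⇒∉ancestors acyclic j∈A k∈B k∉A )
    }

ranking⇒refinement : ∀ {n d} {A B : Type n d} {r : Fin d → ℕ} {M : ℕ} → A ⊆ᵀ B →
                     Ranking A B r → (∀ x → r x < M) → IsRefinement A B
ranking⇒refinement {r = r} {M} A⊆B ρ r<M =
  partition , ranking⇒refinementVia {P = partition} A⊆B (reindex-ranking ρ)
  where open LevelPartition r M r<M

lemma3p2 : ∀ {n d : ℕ} (A B : Type n d) → A ⊆ᵀ B →
    (IsRefinement A B → Acyclic A B) × (Acyclic A B → IsRefinement A B)
lemma3p2 A B A⊆B =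
    (λ (P , via) → ranking⇒acyclic A⊆B (refinementVia⇒ranking {P = P} via))
  , (λ acyclic → ranking⇒refinement A⊆B (acyclic⇒ranking acyclic)
                   (λ x → s≤s (∣p∣≤n (ancestors x))))
  where open Ancestors A⊆B
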